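{- The clause \[C_{base}=P_0(x_1,x_2)\leftarrow P_1(x_1,x_3),P_2(x_1,x_4),P_3(x_2,x_3),P_4(x_2,x_4),P_5(x_3,x_4)\] is irreducible in $\mathcal{H}^{2c}_{2,\infty}$.
   Context: Clauses and fragments. - Clauses are function-free second-order Horn clauses: a head (at most one positive literal) and a finite body of negative literals. Each literal is a predicate variable applied to term variables. - The body size $|C|$ is the number of body literals. - A clause is connected if its literals cannot be partitioned into two non-empty sets with disjoint variable sets. - $\mathcal{H}^{2c}$ (2-connected clauses) is the set of connected clauses in which every term variable occurs in at least two distinct literals. - $\mathcal{H}^{2c}_{2,\infty}$ consists of those clauses whose literals all have arity at most 2. - Clauses are considered modulo variable renaming. SLD-resolution. - Substitutions map term variables to term variables and predicate variables to predicate variables of the same arity. - An SLD-resolution inference $C_1,C_2\vdash C$ is binary resolution without factoring: a body literal (the pivot) of one premise is unified by a most general unifier with the head of the other, and the resolvent consists of the remaining literals with the unifier applied. Irreducibility. Given a theory $T$, a clause $C\in T$ is reducible if it is the resolvent of an SLD-inference whose premises both belong to $T$ and have body size smaller than $|C|$. It is irreducible otherwise. Here $T=\mathcal{H}^{2c}_{2,\infty}$. -}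

module Defs where

open import Data.Nat using (ℕ; _≤_; _<_)
import Data.Nat as ℕ
open import Data.Bool using (Bool; true; false)
open import Data.Maybe using (Maybe; just; nothing)
import Data.Maybe as Maybe
open import Data.List using (List; []; _∷_; _++_; map; length; filter; deduplicate)
open import Data.List.Membership.Propositional using (_∈_)
open import Data.List.Relation.Unary.All using (All)
open import Data.Product using (_×_; _,_; Σ; ∃; ∃-syntax; proj₁; proj₂)
import Data.Product.Properties as ×P
import Data.List.Properties as LP
open import Relation.Nullary using (¬_; ¬?)
open import Relation.Binary.PropositionalEquality using (_≡_)
open import Relation.Binary.Definitions using (DecidableEquality)
open import Function.Definitions using (Injective)
open import Function.Bundles using (_⇔_)

-- A predicate variable is a pair
-- (name , arity); in a literal the arity is the length of the argument
-- list, so a literal is represented by (name , args) and its predicate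
-- variable is (name , length args).

TVar : Set
TVar = ℕ

Literal : Set
Literal = ℕ × List TVar

pname : Literal → ℕ
pname = proj₁

args : Literal → List TVar
args = proj₂

arity : Literal → ℕ
arity l = length (args l)

pvar : Literal → ℕ × ℕ
pvar l = pname l , arity l

_≟L_ : DecidableEquality Literal
_≟L_ = ×P.≡-dec ℕ._≟_ (LP.≡-dec ℕ._≟_)

-- A Horn clause: at most one head literal, and a finite body of
-- (negative) literals.  The body is a list read as a finite set.
record Clause : Set where
  constructor _←_
  field
    head : Maybe Literal
    body : List Literal
open Clause public

size : Clause → ℕ
size C = length (deduplicate _≟L_ (body C))

-- signed literals: true = positive (head), false = negative (body)
SLit : Set
SLit = Bool × Literal

lits : Clause → List SLit
lits C = Maybe.maybe (λ h → (true , h) ∷ []) [] (head C) ++ map (λ l → false , l) (body C)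

_occursIn_ : TVar → SLit → Set
x occursIn l = x ∈ args (proj₂ l)

Connected : Clause → Set
Connected C = (f : SLit → Bool) → ¬ (
    (∃[ l ] (l ∈ lits C × f l ≡ true)) ×
    (∃[ l ] (l ∈ lits C × f l ≡ false)) ×
    (∀ l l' → l ∈ lits C → l' ∈ lits C → f l ≡ true → f l' ≡ false →
       ∀ x → x occursIn l → ¬ (x occursIn l')))

TwoOcc : Clause → Set
TwoOcc C = ∀ x l → l ∈ lits C → x occursIn l →
  ∃[ l' ] (l' ∈ lits C × ¬ (l' ≡ l) × x occursIn l')

ArityAtMost2 : Clause → Set
ArityAtMost2 C = All (λ l → arity (proj₂ l) ≤ 2) (lits C)

InH2c2∞ : Clause → Set
InH2c2∞ C = Connected C × TwoOcc C × ArityAtMost2 C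

-- Substitutions (variables to variables, arity-preserving on
-- predicate variables: the predicate variable (n , a) is sent to
-- (pv n a , a)).

record Subst : Set where
  field
    tv : TVar → TVar
    pv : ℕ → ℕ → ℕ
open Subst public

substL : Subst → Literal → Literal
substL σ (p , xs) = pv σ p (length xs) , map (tv σ) xs

Unifies : Subst → Literal → Literal → Set
Unifies σ l l' = substL σ l ≡ substL σ l'

MGU : Subst → Literal → Literal → Set
MGU σ l l' = Unifies σ l l' ×
  (∀ τ → Unifies τ l l' → ∃[ θ ]
     ((∀ x → tv τ x ≡ tv θ (tv σ x)) × (∀ n a → pv τ n a ≡ pv θ (pv σ n a) a)))

Apart : Clause → Clause → Set
Apart C D =
  (∀ l l' → l ∈ lits C → l' ∈ lits D →
     (∀ x → x occursIn l → ¬ (x occursIn l')) × ¬ (pvar (proj₂ l) ≡ pvar (proj₂ l')))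

-- SLD-resolution inference C₁ , C₂ ⊢ R : the pivot is a body literal of
-- C₂, unified by an mgu with the head of C₁; no factoring.
SLD : Clause → Clause → Clause → Set
SLD C₁ C₂ R = ∃[ h ] ∃[ p ] ∃[ σ ]
  (head C₁ ≡ just h × p ∈ body C₂ × Apart C₁ C₂ × MGU σ p h ×
   R ≡ (Maybe.map (substL σ) (head C₂) ←
        (map (substL σ) (body C₁) ++
         map (substL σ) (filter (λ l → ¬? (l ≟L p)) (body C₂)))))

Renaming : Subst → Set
Renaming ρ = Injective _≡_ _≡_ (tv ρ) × (∀ a → Injective _≡_ _≡_ (λ n → pv ρ n a))

_≈C_ : Clause → Clause → Set
C ≈C D = ∃[ ρ ] (Renaming ρ ×
  Maybe.map (substL ρ) (head C) ≡ head D ×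
  (∀ l → (l ∈ map (substL ρ) (body C)) ⇔ (l ∈ body D)))

Reducible : Clause → Set
Reducible C = ∃[ C₁ ] ∃[ C₂ ] ∃[ R ]
  (InH2c2∞ C₁ × InH2c2∞ C₂ × size C₁ < size C × size C₂ < size C ×
   SLD C₁ C₂ R × R ≈C C)

Irreducible : Clause → Set
Irreducible C = InH2c2∞ C × ¬ Reducible C

Cbase : Clause
Cbase = just (0 , 1 ∷ 2 ∷ []) ←
  ((1 , 1 ∷ 3 ∷ []) ∷ (2 , 1 ∷ 4 ∷ []) ∷ (3 , 2 ∷ 3 ∷ []) ∷
   (4 , 2 ∷ 4 ∷ []) ∷ (5 , 3 ∷ 4 ∷ []) ∷ [])

-- Read Cbase as K₄: its six literals are the edges and its four variables
-- the vertices.  Suppose Cbase is, up to renaming, a resolvent of C₁ and C₂ in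
-- the fragment with |C₁|, |C₂| < 5, and colour each literal of Cbase by the
-- premise it comes from.  A variable occurring in literals of both colours is
-- shared across the premises; since they are apart and an mgu identifies
-- nothing outside the pivot and the head of C₁, it lies in the image of the
-- pivot, so there are at most two such vertices.  The other two vertices are
-- monochromatic and adjacent, so five edges share one colour: either C₁ has
-- five body literals, or C₂ has four besides the pivot.

module Submission where

open import Defs
open import Data.Nat using (ℕ; zero; suc; _≤_; _<_; z≤n; s≤s)
open import Data.Nat.Properties using (≤-trans; ≤-<-trans; ≤-reflexive; ≤-refl; ≤-pred; module ≤-Reasoning)
import Data.Nat as ℕ
open import Data.Bool using (Bool; true; false)
open import Data.Unit using (tt)
import Data.Bool.Properties as Bool
open import Data.Maybe using (just; nothing)
open import Data.Maybe.Properties using (just-injective)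
open import Data.List using (List; []; _∷_; _++_; map; length; filter; replicate)
open import Data.List.Properties using (length-map; length-++-sucʳ)
open import Data.List.Membership.Propositional using (_∈_; _∉_; find)
open import Data.List.Membership.Propositional.Properties
  using (∈-map⁺; ∈-map⁻; ∈-++⁺ˡ; ∈-++⁺ʳ; ∈-++⁻; ∈-∃++; ∈-filter⁻; ∈-deduplicate⁺)
open import Data.List.Membership.DecPropositional ℕ._≟_ using (_∈?_)
open import Data.List.Relation.Unary.All using (All; []; _∷_)
import Data.List.Relation.Unary.All as All
open import Data.List.Relation.Unary.All.Properties using (all-filter)
open import Data.List.Relation.Unary.Any using (Any; here; there; any?)
open import Data.List.Relation.Unary.AllPairs using ([]; _∷_)
open import Data.List.Relation.Unary.Unique.Propositional using (Unique)
import Data.List.Relation.Unary.Unique.Propositional.Properties as Unique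
import Data.List.Relation.Unary.Unique.DecPropositional as UniqueDec
open import Data.Product using (_×_; _,_; ∃-syntax; proj₁; proj₂)
open import Data.Vec using (Vec; []; _∷_)
open import Data.Sum using (inj₁; inj₂)
open import Data.Empty using (⊥-elim)
open import Function using (_∘_)
open import Function.Bundles using (Equivalence)
open import Function.Definitions using (Injective)
open import Relation.Nullary using (¬_; ¬?; yes; no)
open import Relation.Nullary.Decidable using (_×-dec_; toWitness; from-yes)
open import Relation.Unary using (Decidable)
open import Relation.Binary.PropositionalEquality

∈-delete : ∀ {a} {A : Set a} {w y : A} xs ys → w ∈ xs ++ y ∷ ys → w ≢ y → w ∈ xs ++ ys
∈-delete xs ys w∈ w≢y with ∈-++⁻ xs w∈
... | inj₁ w∈xs         = ∈-++⁺ˡ w∈xs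
... | inj₂ (here w≡y)   = ⊥-elim (w≢y w≡y)
... | inj₂ (there w∈ys) = ∈-++⁺ʳ xs w∈ys

Unique⇒length≤ : ∀ {a} {A : Set a} {xs ys : List A} → Unique xs → All (_∈ ys) xs →
                 length xs ≤ length ys
Unique⇒length≤ [] [] = z≤n
Unique⇒length≤ {xs = x ∷ xs} (x∉xs ∷ u) (x∈ys ∷ xs⊆ys) with ∈-∃++ x∈ys
... | ys₁ , ys₂ , refl = ≤-trans (s≤s (Unique⇒length≤ u (shrink x∉xs xs⊆ys)))
                                 (≤-reflexive (sym (length-++-sucʳ ys₁ x ys₂)))
  where
  shrink : ∀ {ws} → All (x ≢_) ws → All (_∈ ys₁ ++ x ∷ ys₂) ws → All (_∈ ys₁ ++ ys₂) ws
  shrink [] [] = []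
  shrink (x≢w ∷ ns) (w∈ ∷ ms) = ∈-delete ys₁ ys₂ w∈ (x≢w ∘ sym) ∷ shrink ns ms

length≤size : ∀ C {ls} → Unique ls → All (_∈ body C) ls → length ls ≤ size C
length≤size C u ls⊆C = Unique⇒length≤ u (All.map (∈-deduplicate⁺ _≟L_) ls⊆C)

head∈lits : ∀ C {h} → head C ≡ just h → (true , h) ∈ lits C
head∈lits (just _ ← _) refl = here refl

body∈lits : ∀ C {l} → l ∈ body C → (false , l) ∈ lits C
body∈lits C l∈C = ∈-++⁺ʳ _ (∈-map⁺ (false ,_) l∈C)

module _ (l l' : Literal) where

  private
    vars : List TVar
    vars = args l ++ args l'

    collapseVar : TVar → TVar
    collapseVar y with y ∈? vars
    ... | yes _ = 0
    ... | no  _ = y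

    collapseVar-∈ : ∀ {y} → y ∈ vars → collapseVar y ≡ 0
    collapseVar-∈ {y} y∈vars with y ∈? vars
    ... | yes _   = refl
    ... | no  y∉vars = ⊥-elim (y∉vars y∈vars)

    collapseVar-∉ : ∀ {y} → y ∉ vars → collapseVar y ≡ y
    collapseVar-∉ {y} y∉vars with y ∈? vars
    ... | yes y∈vars = ⊥-elim (y∉vars y∈vars)
    ... | no  _   = refl

    collapse : Subst
    collapse = record { tv = collapseVar ; pv = λ _ _ → 0 }

    collapse-args : ∀ xs → All (_∈ vars) xs → map collapseVar xs ≡ replicate (length xs) 0
    collapse-args []       []           = refl
    collapse-args (x ∷ xs) (x∈vars ∷ xs∈vars) = cong₂ _∷_ (collapseVar-∈ x∈vars) (collapse-args xs xs∈vars)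

    collapse-unifies : length (args l) ≡ length (args l') → Unifies collapse l l'
    collapse-unifies |l|≡|l'| = cong (0 ,_) (begin
      map collapseVar (args l)               ≡⟨ collapse-args (args l) (All.tabulate ∈-++⁺ˡ) ⟩
      replicate (length (args l)) 0          ≡⟨ cong (λ n → replicate n 0) |l|≡|l'| ⟩
      replicate (length (args l')) 0         ≡⟨ collapse-args (args l') (All.tabulate (∈-++⁺ʳ (args l))) ⟨
      map collapseVar (args l')              ∎)
      where open ≡-Reasoning

  unifier⇒length≡ : ∀ {σ} → Unifies σ l l' → length (args l) ≡ length (args l')
  unifier⇒length≡ {σ} σ-unifies = begin
    length (args l)                  ≡⟨ length-map (tv σ) (args l) ⟨
    length (map (tv σ) (args l))     ≡⟨ cong (length ∘ proj₂) σ-unifies ⟩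
    length (map (tv σ) (args l'))    ≡⟨ length-map (tv σ) (args l') ⟩
    length (args l')                 ∎
    where open ≡-Reasoning

  -- The unifier sending all variables of l and l' to 0 and fixing the others
  -- factors through σ.
  mgu-injective-outside : ∀ {σ u v} → MGU σ l l' → u ∉ args l ++ args l' → v ∉ args l ++ args l' →
                          tv σ u ≡ tv σ v → u ≡ v
  mgu-injective-outside {σ} {u} {v} (σ-unifies , most-general) u∉ v∉ σu≡σv
    with θ , collapse≡θσ , _ ← most-general collapse (collapse-unifies (unifier⇒length≡ {σ} σ-unifies)) =
    begin
      u                    ≡⟨ collapseVar-∉ u∉ ⟨
      collapseVar u        ≡⟨ collapse≡θσ u ⟩
      tv θ (tv σ u)        ≡⟨ cong (tv θ) σu≡σv ⟩
      tv θ (tv σ v)        ≡⟨ collapse≡θσ v ⟨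
      collapseVar v        ≡⟨ collapseVar-∉ v∉ ⟩
      v                    ∎
    where open ≡-Reasoning

Colouring : Set
Colouring = List (Bool × Literal)

count : Bool → Colouring → ℕ
count b = length ∘ filter (λ e → proj₁ e Bool.≟ b)

OccursColoured : Bool → Colouring → TVar → Set
OccursColoured b col x = Any (λ e → proj₁ e ≡ b × x ∈ args (proj₂ e)) col

Bichromatic : Colouring → TVar → Set
Bichromatic col x = OccursColoured true col x × OccursColoured false col x

occursColoured? : ∀ b col → Decidable (OccursColoured b col)
occursColoured? b col x = any? (λ e → (proj₁ e Bool.≟ b) ×-dec (x ∈? args (proj₂ e))) col

bichromatic? : ∀ col → Decidable (Bichromatic col)
bichromatic? col x = occursColoured? true col x ×-dec occursColoured? false col x

bichromaticVariables : List TVar → Colouring → List TVar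
bichromaticVariables vs col = filter (bichromatic? col) vs

module Resolution {C₁ C₂ : Clause} {h p : Literal} {σ ρ : Subst}
  (head₁≡h : head C₁ ≡ just h) (p∈C₂ : p ∈ body C₂) (apart : Apart C₁ C₂) (mgu : MGU σ p h)
  (ρ-injective : Injective _≡_ _≡_ (tv ρ)) where

  F : Literal → Literal
  F = substL ρ ∘ substL σ

  pivotArgs : List TVar
  pivotArgs = args (F p)

  premise : Bool → Clause
  premise true  = C₁
  premise false = C₂

  ImageOf : Bool → Literal → Set
  ImageOf b L = ∃[ sl ] (sl ∈ lits (premise b) × F (proj₂ sl) ≡ L)

  private
    σ-args : map (tv σ) (args p) ≡ map (tv σ) (args h)
    σ-args = cong proj₂ (proj₁ mgu)

    ∉-++ : ∀ {y} → y ∉ args p → y ∉ args h → y ∉ args p ++ args h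
    ∉-++ y∉p y∉h y∈ with ∈-++⁻ (args p) y∈
    ... | inj₁ y∈p = y∉p y∈p
    ... | inj₂ y∈h = y∉h y∈h

  shared∈pivot : ∀ {s₁ l₁ s₂ l₂ x} → (s₁ , l₁) ∈ lits C₁ → (s₂ , l₂) ∈ lits C₂ →
                 x ∈ args (F l₁) → x ∈ args (F l₂) → x ∈ pivotArgs
  shared∈pivot {l₁ = l₁} {l₂ = l₂} l₁∈C₁ l₂∈C₂ x∈l₁ x∈l₂
    with a , a∈ , refl ← ∈-map⁻ (tv ρ) x∈l₁
       | b , b∈ , ρa≡ρb ← ∈-map⁻ (tv ρ) x∈l₂
    with u , u∈l₁ , refl ← ∈-map⁻ (tv σ) a∈
       | v , v∈l₂ , refl ← ∈-map⁻ (tv σ) b∈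
    with u ∈? args h | v ∈? args p
  ... | yes u∈h | _ =
    ∈-map⁺ (tv ρ) (subst (tv σ u ∈_) (sym σ-args) (∈-map⁺ (tv σ) u∈h))
  ... | no _ | yes v∈p =
    subst (λ y → y ∈ pivotArgs) (sym ρa≡ρb) (∈-map⁺ (tv ρ) (∈-map⁺ (tv σ) v∈p))
  ... | no u∉h | no v∉p = ⊥-elim (proj₁ (apart _ _ l₁∈C₁ l₂∈C₂) u u∈l₁ (subst (_∈ args l₂) (sym u≡v) v∈l₂))
    where
    u∉p : u ∉ args p
    u∉p = proj₁ (apart _ _ l₁∈C₁ (body∈lits C₂ p∈C₂)) u u∈l₁
    v∉h : v ∉ args h
    v∉h v∈h = proj₁ (apart _ _ (head∈lits C₁ head₁≡h) l₂∈C₂) v v∈h v∈l₂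
    u≡v : u ≡ v
    u≡v = mgu-injective-outside p h mgu (∉-++ u∉p u∉h) (∉-++ v∉p v∉h) (ρ-injective ρa≡ρb)

  bichromatic∈pivot : ∀ {col x} → (∀ {b L} → (b , L) ∈ col → ImageOf b L) → Bichromatic col x → x ∈ pivotArgs
  bichromatic∈pivot {x = x} col-sound (left , right)
    with (_ , L) , L∈ , refl , x∈L ← find left
       | (_ , L') , L'∈ , refl , x∈L' ← find right
    with _ , l∈C₁ , refl ← col-sound L∈
       | _ , l'∈C₂ , refl ← col-sound L'∈ = shared∈pivot l∈C₁ l'∈C₂ x∈L x∈L'

  bichromaticVariables-bound : ∀ {vs col} → Unique vs → (∀ {b L} → (b , L) ∈ col → ImageOf b L) →
                       length (bichromaticVariables vs col) ≤ arity p
  bichromaticVariables-bound {vs} {col} u col-sound = ≤-trans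
    (Unique⇒length≤ (Unique.filter⁺ (bichromatic? col) u) (All.map (bichromatic∈pivot col-sound) (all-filter (bichromatic? col) vs)))
    (≤-reflexive (trans (length-map (tv ρ) (map (tv σ) (args p))) (length-map (tv σ) (args p))))

  PreimageOn : Bool → Literal → Set
  PreimageOn true  l = l ∈ body C₁
  PreimageOn false l = l ∈ body C₂ × l ≢ p

  data Origin (L : Literal) : Set where
    origin : ∀ b l → PreimageOn b l → F l ≡ L → Origin L

  resolventBody : List Literal
  resolventBody = map (substL σ) (body C₁) ++ map (substL σ) (filter (λ l → ¬? (l ≟L p)) (body C₂))

  origin-of : ∀ {L} → L ∈ map (substL ρ) resolventBody → Origin L
  origin-of L∈ with L' , L'∈ , refl ← ∈-map⁻ (substL ρ) L∈ with ∈-++⁻ (map (substL σ) (body C₁)) L'∈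
  ... | inj₁ L'∈₁ with l , l∈C₁ , refl ← ∈-map⁻ (substL σ) L'∈₁ = origin true l l∈C₁ refl
  ... | inj₂ L'∈₂ with l , l∈ , refl ← ∈-map⁻ (substL σ) L'∈₂ =
    origin false l (∈-filter⁻ (λ l → ¬? (l ≟L p)) l∈) refl

  preimage∈lits : ∀ b {l} → PreimageOn b l → (false , l) ∈ lits (premise b)
  preimage∈lits true  l∈C₁         = body∈lits C₁ l∈C₁
  preimage∈lits false (l∈C₂ , _)   = body∈lits C₂ l∈C₂

  colour : ∀ {L} → Origin L → Bool
  colour (origin b _ _ _) = b

  colouring : ∀ {Ls} → All Origin Ls → Colouring
  colouring []               = []
  colouring {L ∷ _} (o ∷ os) = (colour o , L) ∷ colouring os

  colours : ∀ {Ls} → All Origin Ls → Vec Bool (length Ls)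
  colours []       = []
  colours (o ∷ os) = colour o ∷ colours os

  colouring-sound : ∀ {Ls} (os : All Origin Ls) {b L} → (b , L) ∈ colouring os → ImageOf b L
  colouring-sound (origin b l l∈ refl ∷ _) (here refl) = (false , l) , preimage∈lits b l∈ , refl
  colouring-sound (_ ∷ os)                 (there e∈)  = colouring-sound os e∈

  preimages : Bool → ∀ {Ls} → All Origin Ls → List Literal
  preimages b []                       = []
  preimages b (origin c l _ _ ∷ os) with c Bool.≟ b
  ... | yes _ = l ∷ preimages b os
  ... | no  _ = preimages b os

  preimages-length : ∀ b {Ls} (os : All Origin Ls) → length (preimages b os) ≡ count b (colouring os)
  preimages-length b []                    = refl
  preimages-length b (origin c _ _ _ ∷ os) with c Bool.≟ b
  ... | yes _ = cong suc (preimages-length b os)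
  ... | no  _ = preimages-length b os

  preimages-on : ∀ b {Ls} (os : All Origin Ls) → All (PreimageOn b) (preimages b os)
  preimages-on b []                       = []
  preimages-on b (origin c _ l∈ _ ∷ os) with c Bool.≟ b
  ... | yes refl = l∈ ∷ preimages-on b os
  ... | no  _    = preimages-on b os

  preimages-images : ∀ b {Ls} (os : All Origin Ls) → All (λ l → F l ∈ Ls) (preimages b os)
  preimages-images b []                       = []
  preimages-images b (origin c _ _ refl ∷ os) with c Bool.≟ b
  ... | yes _ = here refl ∷ All.map there (preimages-images b os)
  ... | no  _ = All.map there (preimages-images b os)

  preimages-unique : ∀ b {Ls} (os : All Origin Ls) → Unique Ls → Unique (preimages b os)
  preimages-unique b []                         _            = []
  preimages-unique b (origin c l _ refl ∷ os) (L∉Ls ∷ u) with c Bool.≟ b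
  ... | yes _ = All.map (λ Fl'∈Ls → All.lookup L∉Ls Fl'∈Ls ∘ cong F) (preimages-images b os)
                ∷ preimages-unique b os u
  ... | no  _ = preimages-unique b os u

  count-true≤size : ∀ {Ls} (os : All Origin Ls) → Unique Ls → count true (colouring os) ≤ size C₁
  count-true≤size os u = begin
    count true (colouring os)      ≡⟨ preimages-length true os ⟨
    length (preimages true os)     ≤⟨ length≤size C₁ (preimages-unique true os u) (preimages-on true os) ⟩
    size C₁                        ∎
    where open ≤-Reasoning

  count-false<size : ∀ {Ls} (os : All Origin Ls) → Unique Ls → count false (colouring os) < size C₂
  count-false<size os u = begin-strict
    count false (colouring os)              ≡⟨ preimages-length false os ⟨
    length (preimages false os)             <⟨ ≤-refl ⟩
    length (p ∷ preimages false os)         ≤⟨ length≤size C₂ (p∉ ∷ preimages-unique false os u) (p∈C₂ ∷ All.map proj₁ on) ⟩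
    size C₂                                 ∎
    where
    open ≤-Reasoning
    on : All (PreimageOn false) (preimages false os)
    on = preimages-on false os
    p∉ : All (p ≢_) (preimages false os)
    p∉ = All.map (λ (_ , l≢p) p≡l → l≢p (sym p≡l)) on

data Linked (C : Clause) (l₀ : SLit) : SLit → Set where
  start : Linked C l₀ l₀
  step  : ∀ {l l' x} → l' ∈ lits C → l ∈ lits C → x occursIn l' → x occursIn l →
          Linked C l₀ l' → Linked C l₀ l

linked⇒connected : ∀ {C l₀} → (∀ {l} → l ∈ lits C → Linked C l₀ l) → Connected C
linked⇒connected {C} {l₀} linked f ((l , l∈ , fl≡true) , (l' , l'∈ , fl'≡false) , separated) =
  true≢false (begin
    true  ≡⟨ fl≡true ⟨
    f l   ≡⟨ constant (linked l∈) ⟩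
    f l₀  ≡⟨ constant (linked l'∈) ⟨
    f l'  ≡⟨ fl'≡false ⟩
    false ∎)
  where
  open ≡-Reasoning
  true≢false : true ≢ false
  true≢false ()
  shared⇒same : ∀ {a b x} → a ∈ lits C → b ∈ lits C → x occursIn a → x occursIn b → f a ≡ f b
  shared⇒same {a} {b} a∈ b∈ x∈a x∈b with f a in fa | f b in fb
  ... | true  | true  = refl
  ... | false | false = refl
  ... | true  | false = ⊥-elim (separated a b a∈ b∈ fa fb _ x∈a x∈b)
  ... | false | true  = ⊥-elim (separated b a b∈ a∈ fb fa _ x∈b x∈a)
  constant : ∀ {l} → Linked C l₀ l → f l ≡ f l₀
  constant start                       = refl
  constant (step l'∈ l∈ x∈l' x∈l chain) = trans (shared⇒same l∈ l'∈ x∈l x∈l') (constant chain)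

L₀ L₁ L₂ L₃ L₄ L₅ : Literal
L₀ = 0 , 1 ∷ 2 ∷ []
L₁ = 1 , 1 ∷ 3 ∷ []
L₂ = 2 , 1 ∷ 4 ∷ []
L₃ = 3 , 2 ∷ 3 ∷ []
L₄ = 4 , 2 ∷ 4 ∷ []
L₅ = 5 , 3 ∷ 4 ∷ []

pattern #0 = here refl
pattern #1 = there #0
pattern #2 = there #1
pattern #3 = there #2
pattern #4 = there #3
pattern #5 = there #4

cbase-connected : Connected Cbase
cbase-connected = linked⇒connected linked
  where
  linked : ∀ {l} → l ∈ lits Cbase → Linked Cbase (true , L₀) l
  linked #0 = start
  linked #1 = step #0 #1 #0 #0 start
  linked #2 = step #0 #2 #0 #0 start
  linked #3 = step #0 #3 #1 #0 start
  linked #4 = step #0 #4 #1 #0 start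
  linked #5 = step #1 #5 #1 #0 (linked #1)

cbase-twoOcc : TwoOcc Cbase
cbase-twoOcc _ _ #0 #0 = (false , L₁) , #1 , (λ ()) , #0
cbase-twoOcc _ _ #0 #1 = (false , L₃) , #3 , (λ ()) , #0
cbase-twoOcc _ _ #1 #0 = (true  , L₀) , #0 , (λ ()) , #0
cbase-twoOcc _ _ #1 #1 = (false , L₃) , #3 , (λ ()) , #1
cbase-twoOcc _ _ #2 #0 = (true  , L₀) , #0 , (λ ()) , #0
cbase-twoOcc _ _ #2 #1 = (false , L₄) , #4 , (λ ()) , #1
cbase-twoOcc _ _ #3 #0 = (true  , L₀) , #0 , (λ ()) , #1
cbase-twoOcc _ _ #3 #1 = (false , L₁) , #1 , (λ ()) , #1
cbase-twoOcc _ _ #4 #0 = (true  , L₀) , #0 , (λ ()) , #1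
cbase-twoOcc _ _ #4 #1 = (false , L₂) , #2 , (λ ()) , #1
cbase-twoOcc _ _ #5 #0 = (false , L₁) , #1 , (λ ()) , #1
cbase-twoOcc _ _ #5 #1 = (false , L₂) , #2 , (λ ()) , #1

cbase-arity : ArityAtMost2 Cbase
cbase-arity = ≤-refl ∷ ≤-refl ∷ ≤-refl ∷ ≤-refl ∷ ≤-refl ∷ ≤-refl ∷ []

cbase∈H2c2∞ : InH2c2∞ Cbase
cbase∈H2c2∞ = cbase-connected , cbase-twoOcc , cbase-arity

booleanVectors : ∀ n → List (Vec Bool n)
booleanVectors zero    = [] ∷ []
booleanVectors (suc n) = map (true ∷_) (booleanVectors n) ++ map (false ∷_) (booleanVectors n)

∈-booleanVectors : ∀ {n} (v : Vec Bool n) → v ∈ booleanVectors n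
∈-booleanVectors []          = here refl
∈-booleanVectors (true ∷ v)  = ∈-++⁺ˡ (∈-map⁺ (true ∷_) (∈-booleanVectors v))
∈-booleanVectors (false ∷ v) = ∈-++⁺ʳ _ (∈-map⁺ (false ∷_) (∈-booleanVectors v))

-- The head of Cbase is the image of the head of C₂.
cbaseColouring : Vec Bool 5 → Colouring
cbaseColouring (b₁ ∷ b₂ ∷ b₃ ∷ b₄ ∷ b₅ ∷ []) =
  (false , L₀) ∷ (b₁ , L₁) ∷ (b₂ , L₂) ∷ (b₃ , L₃) ∷ (b₄ , L₄) ∷ (b₅ , L₅) ∷ []

cbaseVariables : List TVar
cbaseVariables = 1 ∷ 2 ∷ 3 ∷ 4 ∷ []

Admissible : Colouring → Set
Admissible col = count true col ≤ 4 × count false col ≤ 4 × length (bichromaticVariables cbaseVariables col) ≤ 2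

admissible? : Decidable Admissible
admissible? col = (count true col ℕ.≤? 4) ×-dec (count false col ℕ.≤? 4)
                ×-dec (length (bichromaticVariables cbaseVariables col) ℕ.≤? 2)

no-admissible-colouring : ∀ v → ¬ Admissible (cbaseColouring v)
no-admissible-colouring v = All.lookup all-inadmissible (∈-booleanVectors v)
  where
  all-inadmissible : All (λ v → ¬ Admissible (cbaseColouring v)) (booleanVectors 5)
  all-inadmissible = toWitness {a? = All.all? (λ v → ¬? (admissible? (cbaseColouring v))) (booleanVectors 5)} tt

cbase-not-reducible : ¬ Reducible Cbase
cbase-not-reducible (_ , (nothing ← _) , _ , _ , _ , _ , _ , (_ , _ , _ , _ , _ , _ , _ , refl) , (_ , _ , () , _))
cbase-not-reducible (C₁ , (just h₂ ← _) , _ , _ , (_ , _ , arity₂) , |C₁|<5 , |C₂|<5 ,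
                     (h , p , σ , head₁≡h , p∈C₂ , apart , mgu , refl) , (ρ , (ρ-injective , _) , head≡ , body⇔)) =
  -- os unfolds to five conses, so cbaseColouring (colours os) is (false , L₀) ∷ colouring os.
  no-admissible-colouring (colours os)
    ( ≤-pred (≤-<-trans (count-true≤size os body-unique) |C₁|<5)
    , ≤-pred (≤-<-trans (count-false<size os body-unique) |C₂|<5)
    , ≤-trans (bichromaticVariables-bound variables-unique sound) (All.lookup arity₂ (body∈lits _ p∈C₂)) )
  where
  open Resolution {σ = σ} {ρ = ρ} head₁≡h p∈C₂ apart mgu ρ-injective
  os : All Origin (body Cbase)
  os = All.tabulate (λ L∈ → origin-of (Equivalence.from (body⇔ _) L∈))
  sound : ∀ {b L} → (b , L) ∈ (false , L₀) ∷ colouring os → ImageOf b L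
  sound (here refl) = (true , h₂) , here refl , just-injective head≡
  sound (there e∈)  = colouring-sound os e∈
  body-unique : Unique (body Cbase)
  body-unique = from-yes (UniqueDec.unique? _≟L_ (body Cbase))
  variables-unique : Unique cbaseVariables
  variables-unique = from-yes (UniqueDec.unique? ℕ._≟_ cbaseVariables)

mainTheorem6 : Irreducible Cbase
mainTheorem6 = cbase∈H2c2∞ , cbase-not-reducible
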